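{- Let $n\ge 4$ be even and $a$ odd with $0<a<a+2<n$. Then $\mathcal{M}_O(n,a,a+2)$ is isomorphic to $\mathrm{HTG}(2,n,a+1)$.
   Context: Subscripts modulo $n$. $\mathcal{M}_O(n,a,b)$ ($a<b$ odd) has vertices $u_0,\dots,u_{n-1},v_0,\dots,v_{n-1}$ and edges $[u_i,u_{i+1}]$ and $[u_i,v_i]$ for all $i$, and $[v_i,v_{i+a}]$, $[v_i,v_{i+b}]$ for all even $i$. For even $0\le\ell<n$, $\mathrm{HTG}(2,n,\ell)$ has vertices $u_0,\dots,u_{n-1},v_0,\dots,v_{n-1}$ and edges $[u_i,u_{i+1}]$, $[v_i,v_{i+1}]$ for all $i$, $[u_i,v_i]$ for odd $i$, and $[u_{i+\ell},v_i]$ for even $i$. -}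

module Defs where

open import Data.Nat using (ℕ; _+_; NonZero)
open import Data.Nat.DivMod using (_mod_)
open import Data.Nat.Divisibility using (_∣_)
open import Data.Fin using (Fin; toℕ)
open import Data.Sum using (_⊎_)
open import Data.Product using (Σ)
open import Relation.Nullary using (¬_)
open import Function.Bundles using (_↔_; _⇔_; Inverse)

data Vtx (n : ℕ) : Set where
  u : Fin n → Vtx n
  v : Fin n → Vtx n

_⊕_ : {n : ℕ} .{{_ : NonZero n}} → Fin n → ℕ → Fin n
_⊕_ {n} i k = (toℕ i + k) mod n

-- parity of an index i ∈ Z_n (n even, so well defined), via its representative in [0,n)
EvenIdx : {n : ℕ} → Fin n → Set
EvenIdx i = 2 ∣ toℕ i

OddIdx : {n : ℕ} → Fin n → Set
OddIdx i = ¬ (2 ∣ toℕ i)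

data MO-edge (n a b : ℕ) .{{_ : NonZero n}} : Vtx n → Vtx n → Set where
  uu : (i : Fin n) → MO-edge n a b (u i) (u (i ⊕ 1))
  uv : (i : Fin n) → MO-edge n a b (u i) (v i)
  va : (i : Fin n) → EvenIdx i → MO-edge n a b (v i) (v (i ⊕ a))
  vb : (i : Fin n) → EvenIdx i → MO-edge n a b (v i) (v (i ⊕ b))

data HTG-edge (n ℓ : ℕ) .{{_ : NonZero n}} : Vtx n → Vtx n → Set where
  uu : (i : Fin n) → HTG-edge n ℓ (u i) (u (i ⊕ 1))
  vv : (i : Fin n) → HTG-edge n ℓ (v i) (v (i ⊕ 1))
  uv-odd  : (i : Fin n) → OddIdx i → HTG-edge n ℓ (u i) (v i)
  uv-even : (i : Fin n) → EvenIdx i → HTG-edge n ℓ (u (i ⊕ ℓ)) (v i)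

Sym : {V : Set} → (V → V → Set) → V → V → Set
Sym E x y = E x y ⊎ E y x

MO-adj : (n a b : ℕ) .{{_ : NonZero n}} → Vtx n → Vtx n → Set
MO-adj n a b = Sym (MO-edge n a b)

HTG-adj : (n ℓ : ℕ) .{{_ : NonZero n}} → Vtx n → Vtx n → Set
HTG-adj n ℓ = Sym (HTG-edge n ℓ)

Isomorphic : {V W : Set} → (V → V → Set) → (W → W → Set) → Set
Isomorphic {V} {W} G H =
  Σ (V ↔ W) λ f → ∀ x y → G x y ⇔ H (Inverse.to f x) (Inverse.to f y)

{-# OPTIONS --safe #-}

-- The isomorphism sends u_i to v_i, an odd v_i to u_i and an even v_i to u_{i+ℓ},
-- where ℓ = a + 1.  The u-cycle of M_O becomes the v-cycle of HTG, its spokes become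
-- the rungs u_iv_i (i odd) and u_{i+ℓ}v_i (i even), and the two chords v_iv_{i+a},
-- v_iv_{i+a+2} at an even v_i become the two u-edges at u_{i+ℓ}.  The inverse shifts
-- back by d = n - ℓ; as ℓ and n are even, both shifts preserve index parity.
module Submission where

open import Defs
open import Data.Nat using (ℕ; zero; suc; _+_; _≤_; _<_; NonZero; _%_)
open import Data.Nat.Properties
  using (+-comm; +-assoc; +-monoʳ-≤; n≤1+n; n<1+n; m+[n∸m]≡n; <⇒≤; ≤-trans)
open import Data.Nat.DivMod using (m%n<n; [m+n]%n≡m%n; %-distribˡ-+; m%n%n≡m%n; m<n⇒m%n≡m)
open import Data.Nat.Divisibility
  using (_∣_; _∣?_; divides; ∣-refl; ∣m∣n⇒∣m+n; ∣m+n∣m⇒∣n; >⇒∤; ∣n∣m%n⇒∣m; %-presˡ-∣)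
open import Data.Fin using (Fin; toℕ)
open import Data.Fin.Properties using (toℕ-fromℕ<; toℕ-injective; toℕ<n)
open import Data.Sum using (_⊎_; inj₁; inj₂; swap)
open import Data.Product using (_,_)
open import Relation.Nullary using (¬_; yes; no; contradiction)
open import Relation.Binary.PropositionalEquality
  using (_≡_; refl; sym; trans; cong; subst; subst₂; module ≡-Reasoning)
open import Function.Bundles using (mk↔ₛ′; mk⇔)
open import Data.Nat.Tactic.RingSolver using (solve-∀)

2∣m⊎2∣1+m : ∀ m → 2 ∣ m ⊎ 2 ∣ suc m
2∣m⊎2∣1+m zero = inj₁ (divides 0 refl)
2∣m⊎2∣1+m (suc m) with 2∣m⊎2∣1+m m
... | inj₁ 2∣m    = inj₂ (∣m∣n⇒∣m+n ∣-refl 2∣m)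
... | inj₂ 2∣1+m  = inj₁ 2∣1+m

2∤m⇒2∣m+1 : ∀ {m} → ¬ 2 ∣ m → 2 ∣ m + 1
2∤m⇒2∣m+1 {m} 2∤m with 2∣m⊎2∣1+m m
... | inj₁ 2∣m   = contradiction 2∣m 2∤m
... | inj₂ 2∣1+m = subst (2 ∣_) (+-comm 1 m) 2∣1+m

private
  variable
    n : ℕ

module _ .{{_ : NonZero n}} where

  toℕ-⊕ : (i : Fin n) (k : ℕ) → toℕ (i ⊕ k) ≡ (toℕ i + k) % n
  toℕ-⊕ i k = toℕ-fromℕ< (m%n<n (toℕ i + k) n)

  ⊕-assoc : (i : Fin n) (k m : ℕ) → (i ⊕ k) ⊕ m ≡ i ⊕ (k + m)
  ⊕-assoc i k m = toℕ-injective (begin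
    toℕ ((i ⊕ k) ⊕ m)                 ≡⟨ toℕ-⊕ (i ⊕ k) m ⟩
    (toℕ (i ⊕ k) + m) % n             ≡⟨ cong (λ z → (z + m) % n) (toℕ-⊕ i k) ⟩
    ((toℕ i + k) % n + m) % n         ≡⟨ %-distribˡ-+ ((toℕ i + k) % n) m n ⟩
    ((toℕ i + k) % n % n + m % n) % n ≡⟨ cong (λ z → (z + m % n) % n) (m%n%n≡m%n (toℕ i + k) n) ⟩
    ((toℕ i + k) % n + m % n) % n     ≡⟨ sym (%-distribˡ-+ (toℕ i + k) m n) ⟩
    (toℕ i + k + m) % n               ≡⟨ cong (_% n) (+-assoc (toℕ i) k m) ⟩
    (toℕ i + (k + m)) % n             ≡⟨ sym (toℕ-⊕ i (k + m)) ⟩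
    toℕ (i ⊕ (k + m))                 ∎)
    where open ≡-Reasoning

  ⊕-wrap : (i : Fin n) {k r : ℕ} → k ≡ n + r → i ⊕ k ≡ i ⊕ r
  ⊕-wrap i {k} {r} refl = toℕ-injective (begin
    toℕ (i ⊕ (n + r))     ≡⟨ toℕ-⊕ i (n + r) ⟩
    (toℕ i + (n + r)) % n ≡⟨ cong (_% n) (+-wrap (toℕ i)) ⟩
    (toℕ i + r + n) % n   ≡⟨ [m+n]%n≡m%n (toℕ i + r) n ⟩
    (toℕ i + r) % n       ≡⟨ sym (toℕ-⊕ i r) ⟩
    toℕ (i ⊕ r)           ∎)
    where
    open ≡-Reasoning
    +-wrap : ∀ x → x + (n + r) ≡ x + r + n
    +-wrap x = trans (cong (x +_) (+-comm n r)) (sym (+-assoc x r n))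

  ⊕-identityʳ : (i : Fin n) → i ⊕ 0 ≡ i
  ⊕-identityʳ i = toℕ-injective
    (trans (toℕ-⊕ i 0) (trans (cong (_% n) (+-comm (toℕ i) 0)) (m<n⇒m%n≡m (toℕ<n i))))

  ⊕-cancel : (i : Fin n) {k m : ℕ} → k + m ≡ n → (i ⊕ k) ⊕ m ≡ i
  ⊕-cancel i {k} {m} k+m≡n = begin
    (i ⊕ k) ⊕ m ≡⟨ ⊕-assoc i k m ⟩
    i ⊕ (k + m) ≡⟨ ⊕-wrap i (trans k+m≡n (sym (+-comm n 0))) ⟩
    i ⊕ 0       ≡⟨ ⊕-identityʳ i ⟩
    i           ∎
    where open ≡-Reasoning

  module _ (2∣n : 2 ∣ n) where

    even-⊕ : (i : Fin n) {k : ℕ} → EvenIdx i → 2 ∣ k → EvenIdx (i ⊕ k)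
    even-⊕ i {k} 2∣i 2∣k =
      subst (2 ∣_) (sym (toℕ-⊕ i k)) (%-presˡ-∣ (∣m∣n⇒∣m+n 2∣i 2∣k) 2∣n)

    odd-⊕ : (i : Fin n) {k : ℕ} → EvenIdx i → ¬ 2 ∣ k → OddIdx (i ⊕ k)
    odd-⊕ i {k} 2∣i 2∤k 2∣i⊕k =
      2∤k (∣m+n∣m⇒∣n (∣n∣m%n⇒∣m 2∣n (subst (2 ∣_) (toℕ-⊕ i k) 2∣i⊕k)) 2∣i)

    even-⊕-1 : (i : Fin n) → OddIdx i → EvenIdx (i ⊕ 1)
    even-⊕-1 i 2∤i = subst (2 ∣_) (sym (toℕ-⊕ i 1)) (%-presˡ-∣ (2∤m⇒2∣m+1 2∤i) 2∣n)

Sym-map : {V W : Set} {E : V → V → Set} {F : W → W → Set} (f : V → W) →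
  (∀ {x y} → E x y → Sym F (f x) (f y)) → ∀ {x y} → Sym E x y → Sym F (f x) (f y)
Sym-map f f-edge (inj₁ e) = f-edge e
Sym-map f f-edge (inj₂ e) = swap (f-edge e)

isomorphic-by-inverses : {V W : Set} {E : V → V → Set} {F : W → W → Set} (f : V → W) (g : W → V) →
  (∀ y → f (g y) ≡ y) → (∀ x → g (f x) ≡ x) →
  (∀ {x y} → E x y → Sym F (f x) (f y)) → (∀ {x y} → F x y → Sym E (g x) (g y)) →
  Isomorphic (Sym E) (Sym F)
isomorphic-by-inverses {E = E} {F} f g f∘g g∘f f-edge g-edge = mk↔ₛ′ f g f∘g g∘f , λ x y →
  mk⇔ (Sym-map {E = E} {F = F} f f-edge)
      (λ h → subst₂ (Sym E) (g∘f x) (g∘f y) (Sym-map {E = F} {F = E} g g-edge h))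

module MO≅HTG .{{_ : NonZero n}} (2∣n : 2 ∣ n) {a d : ℕ} (2∤a : ¬ 2 ∣ a) (a+1+d≡n : a + 1 + d ≡ n) where

  ℓ : ℕ
  ℓ = a + 1

  2∣ℓ : 2 ∣ ℓ
  2∣ℓ = 2∤m⇒2∣m+1 2∤a

  2∣d : 2 ∣ d
  2∣d = ∣m+n∣m⇒∣n (subst (2 ∣_) (sym a+1+d≡n) 2∣n) 2∣ℓ

  2∤1 : ¬ 2 ∣ 1
  2∤1 = >⇒∤ (n<1+n 1)

  2∤a+2 : ¬ 2 ∣ a + 2
  2∤a+2 2∣a+2 = 2∤a (∣m+n∣m⇒∣n (subst (2 ∣_) (+-comm a 2) 2∣a+2) ∣-refl)

  d+ℓ≡n : d + ℓ ≡ n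
  d+ℓ≡n = trans (+-comm d ℓ) a+1+d≡n

  d+[a+2]≡n+1 : d + (a + 2) ≡ n + 1
  d+[a+2]≡n+1 = trans (rearrange a d) (cong (_+ 1) a+1+d≡n)
    where
    rearrange : ∀ a d → d + (a + 2) ≡ a + 1 + d + 1
    rearrange = solve-∀

  1+[d+a]≡n : 1 + (d + a) ≡ n
  1+[d+a]≡n = trans (rearrange a d) a+1+d≡n
    where
    rearrange : ∀ a d → 1 + (d + a) ≡ a + 1 + d
    rearrange = solve-∀

  MO : Vtx n → Vtx n → Set
  MO = MO-edge n a (a + 2)

  HTG : Vtx n → Vtx n → Set
  HTG = HTG-edge n ℓ

  to : Vtx n → Vtx n
  to (u i) = v i
  to (v i) with 2 ∣? toℕ i
  ... | yes _ = u (i ⊕ ℓ)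
  ... | no _  = u i

  from : Vtx n → Vtx n
  from (u i) with 2 ∣? toℕ i
  ... | yes _ = v (i ⊕ d)
  ... | no _  = v i
  from (v i) = u i

  to-even : (i : Fin n) → EvenIdx i → to (v i) ≡ u (i ⊕ ℓ)
  to-even i 2∣i with 2 ∣? toℕ i
  ... | yes _  = refl
  ... | no 2∤i = contradiction 2∣i 2∤i

  to-odd : (i : Fin n) → OddIdx i → to (v i) ≡ u i
  to-odd i 2∤i with 2 ∣? toℕ i
  ... | yes 2∣i = contradiction 2∣i 2∤i
  ... | no _    = refl

  from-even : (i : Fin n) → EvenIdx i → from (u i) ≡ v (i ⊕ d)
  from-even i 2∣i with 2 ∣? toℕ i
  ... | yes _  = refl
  ... | no 2∤i = contradiction 2∣i 2∤i

  from-odd : (i : Fin n) → OddIdx i → from (u i) ≡ v i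
  from-odd i 2∤i with 2 ∣? toℕ i
  ... | yes 2∣i = contradiction 2∣i 2∤i
  ... | no _    = refl

  from-u-⊕ℓ : (i : Fin n) → EvenIdx i → from (u (i ⊕ ℓ)) ≡ v i
  from-u-⊕ℓ i 2∣i = trans (from-even (i ⊕ ℓ) (even-⊕ 2∣n i 2∣i 2∣ℓ)) (cong v (⊕-cancel i a+1+d≡n))

  to-v-⊕d : (i : Fin n) → EvenIdx i → to (v (i ⊕ d)) ≡ u i
  to-v-⊕d i 2∣i = trans (to-even (i ⊕ d) (even-⊕ 2∣n i 2∣i 2∣d)) (cong u (⊕-cancel i d+ℓ≡n))

  to∘from : ∀ x → to (from x) ≡ x
  to∘from (u i) with 2 ∣? toℕ i
  ... | yes 2∣i = to-v-⊕d i 2∣i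
  ... | no 2∤i  = to-odd i 2∤i
  to∘from (v i) = refl

  from∘to : ∀ x → from (to x) ≡ x
  from∘to (u i) = refl
  from∘to (v i) with 2 ∣? toℕ i
  ... | yes 2∣i = from-u-⊕ℓ i 2∣i
  ... | no 2∤i  = from-odd i 2∤i

  HTG-uu : ∀ {i j} → i ⊕ 1 ≡ j → HTG (u i) (u j)
  HTG-uu {i} refl = uu i

  MO-va : ∀ {i j} → EvenIdx i → i ⊕ a ≡ j → MO (v i) (v j)
  MO-va {i} 2∣i refl = va i 2∣i

  MO-vb : ∀ {i j} → EvenIdx i → i ⊕ (a + 2) ≡ j → MO (v i) (v j)
  MO-vb {i} 2∣i refl = vb i 2∣i

  to-edge : ∀ {x y} → MO x y → Sym HTG (to x) (to y)
  to-edge (uu i) = inj₁ (vv i)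
  to-edge (uv i) with 2 ∣? toℕ i
  ... | yes 2∣i = inj₂ (uv-even i 2∣i)
  ... | no 2∤i  = inj₂ (uv-odd i 2∤i)
  to-edge (va i 2∣i)
    rewrite to-even i 2∣i | to-odd (i ⊕ a) (odd-⊕ 2∣n i 2∣i 2∤a) =
    inj₂ (HTG-uu (⊕-assoc i a 1))
  to-edge (vb i 2∣i)
    rewrite to-even i 2∣i | to-odd (i ⊕ (a + 2)) (odd-⊕ 2∣n i 2∣i 2∤a+2) =
    inj₁ (HTG-uu (trans (⊕-assoc i ℓ 1) (cong (i ⊕_) (+-assoc a 1 1))))

  from-edge : ∀ {x y} → HTG x y → Sym MO (from x) (from y)
  from-edge (uu i) with 2 ∣? toℕ i
  ... | yes 2∣i rewrite from-odd (i ⊕ 1) (odd-⊕ 2∣n i 2∣i 2∤1) =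
    inj₁ (MO-vb (even-⊕ 2∣n i 2∣i 2∣d) (trans (⊕-assoc i d (a + 2)) (⊕-wrap i d+[a+2]≡n+1)))
  ... | no 2∤i rewrite from-even (i ⊕ 1) (even-⊕-1 2∣n i 2∤i) =
    inj₂ (MO-va (even-⊕ 2∣n (i ⊕ 1) (even-⊕-1 2∣n i 2∤i) 2∣d)
                (trans (⊕-assoc (i ⊕ 1) d a) (⊕-cancel i 1+[d+a]≡n)))
  from-edge (vv i) = inj₁ (uu i)
  from-edge (uv-odd i 2∤i) rewrite from-odd i 2∤i = inj₂ (uv i)
  from-edge (uv-even i 2∣i) rewrite from-u-⊕ℓ i 2∣i = inj₂ (uv i)

  isomorphic : Isomorphic (MO-adj n a (a + 2)) (HTG-adj n ℓ)
  isomorphic = isomorphic-by-inverses {E = MO} {F = HTG} to from to∘from from∘to to-edge from-edge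

theorem5p1 : (n a : ℕ) .{{_ : NonZero n}} → 4 ≤ n → 2 ∣ n → ¬ (2 ∣ a) → 0 < a → a + 2 < n →
    Isomorphic (MO-adj n a (a + 2)) (HTG-adj n (a + 1))
theorem5p1 n a _ 2∣n 2∤a _ a+2<n = MO≅HTG.isomorphic 2∣n 2∤a (m+[n∸m]≡n a+1≤n)
  where
  a+1≤n : a + 1 ≤ n
  a+1≤n = ≤-trans (+-monoʳ-≤ a (n≤1+n 1)) (<⇒≤ a+2<n)
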